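{- Let $p$ and $q$ be distinct primes. (i) If $n = p^2 q$ with $p, q \geq 2$, then $\Gamma(\mathbb{Z}_n)$ is very cost effective. (ii) If $n = p^2 q^2$ with $p, q \geq 3$ and $p < q$, then $\Gamma(\mathbb{Z}_n)$ is very cost effective.
   Context: $\mathbb{Z}_n$ is the ring of residue classes modulo $n$. The zero-divisor graph $\Gamma(\mathbb{Z}_n)$ has as vertices the nonzero zero-divisors of $\mathbb{Z}_n$, two distinct vertices $x,y$ being adjacent iff $xy = 0$. For a graph $G=(V,E)$, $N(v)$ denotes the open neighborhood of $v$. Given $S \subseteq V$, a vertex $v \in S$ is very cost effective if $|N(v)\cap S| < |N(v) \cap (V\setminus S)|$; a set $S$ is very cost effective if every vertex of $S$ is very cost effective. A bipartition $\{S, V\setminus S\}$ of $V$ is very cost effective if both parts are very cost effective sets, and $G$ is (a) very cost effective (graph) if it has a very cost effective bipartition. -}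

module Defs where

open import Data.Nat using (ℕ; zero; suc; _*_; _%_; _<_; NonZero)
open import Data.Nat.Properties using (_≟_)
open import Data.Nat.Divisibility using (_∣_; _∣?_)
open import Data.Fin using (Fin; toℕ)
open import Data.Fin.Properties using () renaming (_≟_ to _≟ᶠ_)
open import Data.List using (List; length; filter)
open import Data.List.Base using (allFin)
open import Data.Bool using (Bool; true; false; T)
open import Data.Product using (Σ; _×_; ∃)
open import Relation.Nullary using (¬_; Dec; yes; no)
open import Relation.Nullary.Decidable using (_×-dec_; ¬?; ⌊_⌋)
open import Relation.Binary.PropositionalEquality using (_≡_)
open import Data.List.Relation.Unary.Any using (any?)
open import Data.List.Membership.Propositional using ()

-- A finite simple graph on the vertex set {v : Fin m | vert v}, with
-- decidable vertex predicate and decidable (symmetric) adjacency.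

record FinGraph (m : ℕ) : Set₁ where
  field
    vert  : Fin m → Set
    vert? : (v : Fin m) → Dec (vert v)
    adj   : Fin m → Fin m → Set
    adj?  : (u v : Fin m) → Dec (adj u v)

module _ {m : ℕ} (G : FinGraph m) where
  open FinGraph G

  degIn : (Fin m → Bool) → Fin m → ℕ
  degIn S v = length (filter (λ u → (vert? u ×-dec adj? v u) ×-dec Data.Bool._≟_ (S u) true) (allFin m))

  degOut : (Fin m → Bool) → Fin m → ℕ
  degOut S v = length (filter (λ u → (vert? u ×-dec adj? v u) ×-dec Data.Bool._≟_ (S u) false) (allFin m))

  -- a set S (given as a Bool-valued indicator; only its vertices of G matter)
  -- is very cost effective if every vertex v ∈ S has |N(v) ∩ S| < |N(v) ∩ (V∖S)|
  VeryCostEffectiveSet : (Fin m → Bool) → Set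
  VeryCostEffectiveSet S = (v : Fin m) → vert v → S v ≡ true → degIn S v < degOut S v

  compl : (Fin m → Bool) → Fin m → Bool
  compl S v = Data.Bool.not (S v)

  VeryCostEffectiveBipartition : (Fin m → Bool) → Set
  VeryCostEffectiveBipartition S = VeryCostEffectiveSet S × VeryCostEffectiveSet (compl S)

  VeryCostEffectiveGraph : Set
  VeryCostEffectiveGraph = ∃ λ (S : Fin m → Bool) → VeryCostEffectiveBipartition S

module _ (n : ℕ) where

  mulZero : Fin n → Fin n → Set
  mulZero x y = n ∣ (toℕ x * toℕ y)

  mulZero? : (x y : Fin n) → Dec (mulZero x y)
  mulZero? x y = n ∣? (toℕ x * toℕ y)

  nonzero : Fin n → Set
  nonzero x = ¬ (toℕ x ≡ 0)

  NonzeroZeroDivisor : Fin n → Set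
  NonzeroZeroDivisor x = nonzero x × Σ (Fin n) (λ y → nonzero y × mulZero x y)

  NonzeroZeroDivisor? : (x : Fin n) → Dec (NonzeroZeroDivisor x)
  NonzeroZeroDivisor? x with ¬? (toℕ x ≟ 0) | any? (λ y → ¬? (toℕ y ≟ 0) ×-dec mulZero? x y) (allFin n)
  ... | no ¬p | _ = no λ z → ¬p (Data.Product.proj₁ z)
  ... | yes p | yes a = yes (p , anyWit a)
    where
      open import Data.Product using (_,_)
      open import Data.List.Relation.Unary.Any using (Any; here; there)
      anyWit : ∀ {xs : List (Fin n)} → Any (λ y → nonzero y × mulZero x y) xs → Σ (Fin n) (λ y → nonzero y × mulZero x y)
      anyWit (here {y} q) = y , q
      anyWit (there a) = anyWit a
  ... | yes p | no ¬a = no λ { (_ Data.Product., (y Data.Product., q)) → ¬a (Data.List.Membership.Propositional.lose (Data.List.Membership.Propositional.Properties.∈-allFin y) q) }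
    where import Data.List.Membership.Propositional.Properties

  ZDadj : Fin n → Fin n → Set
  ZDadj x y = ¬ (x ≡ y) × mulZero x y

  ZDadj? : (x y : Fin n) → Dec (ZDadj x y)
  ZDadj? x y = ¬? (x ≟ᶠ y) ×-dec mulZero? x y

  ZeroDivisorGraph : FinGraph n
  ZeroDivisorGraph = record
    { vert = NonzeroZeroDivisor ; vert? = NonzeroZeroDivisor?
    ; adj = ZDadj ; adj? = ZDadj? }

module Submission where

-- A bipartition S is very cost effective as soon as every vertex v
-- is "outnumbered": there is an injection from the neighbours of v of its own
-- colour into the neighbours of the other colour which misses at least one of
-- the latter.  Counting along such an injection gives the strict inequality
-- |N(v) ∩ S| < |N(v) ∖ S| demanded at v, whichever part v lies in.
--
-- After this counting argument and some coprimality lemmas, each part colours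
-- the vertices explicitly:
--  * n = p²q: colour u by "q ∤ u".  Vertices outside pqℤ have no neighbour of
--    their own colour; for v ∈ pqℤ the shift u ↦ u + p does the job.
--  * n = p²q², r = pq: off rℤ colour u by "q ∣ u".  The multiples j·r, 0 < j < r,
--    form a clique, coloured by pairing j with j ± 1 (r - 1 is even) and giving
--    partners opposite colours, multiples of q true and of p false.  The pairing
--    outnumbers every vertex of the clique; the others have no neighbour of
--    their own colour.

open import Defs
open import Data.Nat
  using (ℕ; zero; suc; _+_; _*_; _^_; _<_; _≤_; _/_; _%_; z≤n; s≤s; _<?_;
         NonZero; nonTrivial⇒n>1; ≢-nonZero⁻¹; >-nonZero)
open import Data.Nat.Properties
open import Data.Nat.DivMod using (m%n<n; m<n⇒m%n≡m; m*n/n≡m)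
open import Data.Nat.Divisibility
open import Data.Nat.Coprimality using (Coprime; coprime-divisor)
open import Data.Nat.Primality using (Prime; prime⇒irreducible; prime⇒nonZero; prime⇒nonTrivial; euclidsLemma; prime[2])
open import Data.Nat.Tactic.RingSolver using (solve-∀)
open import Data.Fin using (Fin; toℕ; fromℕ<)
open import Data.Fin.Properties using (toℕ-fromℕ<; toℕ-injective; toℕ<n)
open import Data.Bool using (Bool; true; false; not; _∧_; if_then_else_)
open import Data.Bool.Properties using (not-injective; not-involutive; not-¬)
open import Data.List using (List; []; _∷_; length; filter; map)
open import Data.List.Base using (allFin)
open import Data.List.Properties using (filter-notAll; length-map)
open import Data.List.Membership.Propositional using (_∈_)
open import Data.List.Membership.Propositional.Properties using (∈-filter⁺; ∈-filter⁻; ∈-allFin; ∈-map⁻)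
open import Data.List.Relation.Unary.Any using (Any; here; there)
import Data.List.Relation.Unary.Any as Any
open import Data.List.Relation.Unary.All using (All; []; _∷_)
import Data.List.Relation.Unary.All as All
open import Data.List.Relation.Unary.All.Properties using (all-filter) renaming (map⁺ to All-map⁺)
open import Data.List.Relation.Unary.AllPairs using ([]; _∷_)
open import Data.List.Relation.Unary.Unique.Propositional using (Unique)
open import Data.List.Relation.Unary.Unique.Propositional.Properties using (allFin⁺; filter⁺)
open import Data.Product using (Σ-syntax; _×_; _,_; proj₁; proj₂)
open import Data.Sum using (_⊎_; inj₁; inj₂)
open import Data.Empty using (⊥; ⊥-elim)
open import Function using (id)
open import Relation.Nullary using (¬_; Dec; yes; no; does; ¬?)
open import Relation.Nullary.Decidable using (dec-true; dec-false)
open import Relation.Unary using (Decidable)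
open import Relation.Binary.Definitions using (DecidableEquality; tri<; tri≈; tri>)
open import Relation.Binary.PropositionalEquality
  using (_≡_; _≢_; refl; sym; trans; cong; cong₂; subst; ≢-sym; module ≡-Reasoning)

-- Counting along an injection

unique-⊆⇒length-≤ : {A : Set} → DecidableEquality A → (xs ys : List A) →
  Unique xs → (∀ {z} → z ∈ xs → z ∈ ys) → length xs ≤ length ys
unique-⊆⇒length-≤ _≟_ [] ys _ _ = z≤n
unique-⊆⇒length-≤ _≟_ (x ∷ xs) ys (x∉xs ∷ xs-unique) xs⊆ys =
  ≤-trans (s≤s (unique-⊆⇒length-≤ _≟_ xs ys-x xs-unique xs⊆ys-x))
          (filter-notAll (λ y → ¬? (y ≟ x)) ys x∈ys)
  where
    ys-x : List _
    ys-x = filter (λ y → ¬? (y ≟ x)) ys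
    xs⊆ys-x : ∀ {z} → z ∈ xs → z ∈ ys-x
    xs⊆ys-x z∈xs =
      ∈-filter⁺ (λ y → ¬? (y ≟ x)) (xs⊆ys (there z∈xs)) (λ z≡x → All.lookup x∉xs z∈xs (sym z≡x))
    x∈ys : Any (λ y → ¬ ¬ (y ≡ x)) ys
    x∈ys = Any.map (λ x≡y y≢x → y≢x (sym x≡y)) (xs⊆ys (here refl))

map-unique : {B : Set} {P : B → Set} (f : B → B) →
  (∀ u w → P u → P w → f u ≡ f w → u ≡ w) →
  ∀ xs → All P xs → Unique xs → Unique (map f xs)
map-unique f inj [] _ _ = []
map-unique f inj (x ∷ xs) (px ∷ pxs) (x∉xs ∷ xs-unique) =
  All-map⁺ (All.map (λ { (x≢y , py) fx≡fy → x≢y (inj x _ px py fx≡fy) }) (All.zip (x∉xs , pxs)))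
  ∷ map-unique f inj xs pxs xs-unique

injection⇒count-< : ∀ {m} {P Q : Fin m → Set} (P? : Decidable P) (Q? : Decidable Q) (f : Fin m → Fin m) →
  (∀ u → P u → Q (f u)) → (∀ u w → P u → P w → f u ≡ f w → u ≡ w) →
  (w : Fin m) → Q w → (∀ u → P u → f u ≢ w) →
  length (filter P? (allFin m)) < length (filter Q? (allFin m))
injection⇒count-< {m} {P} P? Q? f f-maps f-inj w Qw w-missed =
  subst (λ k → suc k ≤ _) (length-map f Ps)
    (unique-⊆⇒length-≤ Data.Fin._≟_ (w ∷ map f Ps) (filter Q? (allFin m)) image-unique image⊆Qs)
  where
    Ps : List (Fin m)
    Ps = filter P? (allFin m)
    all-P : All P Ps
    all-P = all-filter P? (allFin m)
    image-unique : Unique (w ∷ map f Ps)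
    image-unique =
      All-map⁺ (All.map (λ {u} Pu w≡fu → w-missed u Pu (sym w≡fu)) all-P)
      ∷ map-unique f f-inj Ps all-P (filter⁺ P? (allFin⁺ m))
    image⊆Qs : ∀ {z} → z ∈ (w ∷ map f Ps) → z ∈ filter Q? (allFin m)
    image⊆Qs (here refl) = ∈-filter⁺ Q? (∈-allFin w) Qw
    image⊆Qs (there z∈fPs) with ∈-map⁻ f z∈fPs
    ... | u , u∈Ps , refl = ∈-filter⁺ Q? (∈-allFin (f u)) (f-maps u (proj₂ (∈-filter⁻ P? {xs = allFin m} u∈Ps)))

-- A local criterion for very cost effective bipartitions

module Criterion {m : ℕ} (G : FinGraph m) where
  open FinGraph G

  Neighbour : (Fin m → Bool) → Fin m → Bool → Fin m → Set
  Neighbour S v b u = (vert u × adj v u) × S u ≡ b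

  record Outnumbered (S : Fin m → Bool) (v : Fin m) : Set where
    field
      f : Fin m → Fin m
      f-opposite : ∀ u → Neighbour S v (S v) u → Neighbour S v (not (S v)) (f u)
      f-injective : ∀ u w → Neighbour S v (S v) u → Neighbour S v (S v) w → f u ≡ f w → u ≡ w
      spare : Fin m
      spare-opposite : Neighbour S v (not (S v)) spare
      spare-missed : ∀ u → Neighbour S v (S v) u → f u ≢ spare

  -- The count behind the criterion, for any predicates P ⊆ "same colour" and
  -- Q ⊇ "other colour" (the two parts phrase these slightly differently).
  outnumbered⇒count-< : ∀ {S v} {P Q : Fin m → Set} (P? : Decidable P) (Q? : Decidable Q) →
    (∀ {u} → P u → Neighbour S v (S v) u) → (∀ {u} → Neighbour S v (not (S v)) u → Q u) →
    Outnumbered S v → length (filter P? (allFin m)) < length (filter Q? (allFin m))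
  outnumbered⇒count-< P? Q? P⇒same opposite⇒Q o =
    injection⇒count-< P? Q? f (λ u Pu → opposite⇒Q (f-opposite u (P⇒same Pu)))
      (λ u w Pu Pw → f-injective u w (P⇒same Pu) (P⇒same Pw))
      spare (opposite⇒Q spare-opposite) (λ u Pu → spare-missed u (P⇒same Pu))
    where open Outnumbered o

  outnumbered⇒veryCostEffective : (S : Fin m → Bool) → (∀ v → vert v → Outnumbered S v) →
    VeryCostEffectiveGraph G
  outnumbered⇒veryCostEffective S outnumbered = S , part-S , part-compl
    where
      part-S : VeryCostEffectiveSet G S
      part-S v v-vert Sv≡true = outnumbered⇒count-< _ _
        (λ { (nb , Su) → nb , trans Su (sym Sv≡true) })
        (λ { (nb , Su) → nb , trans Su (cong not Sv≡true) })
        (outnumbered v v-vert)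
      part-compl : VeryCostEffectiveSet G (compl G S)
      part-compl v v-vert notSv≡true = outnumbered⇒count-< _ _
        (λ { (nb , notSu) → nb , not-injective (trans notSu (sym notSv≡true)) })
        (λ { (nb , Su) → nb , trans (cong not Su) (trans (not-involutive (S v)) Sv≡false) })
        (outnumbered v v-vert)
        where
          Sv≡false : S v ≡ false
          Sv≡false = trans (sym (not-involutive (S v))) (cong not notSv≡true)

  outnumbered-trivially : ∀ S v → (∀ u → ¬ Neighbour S v (S v) u) →
    ∀ w → Neighbour S v (not (S v)) w → Outnumbered S v
  outnumbered-trivially S v none w w-opposite = record
    { f = id
    ; f-opposite = λ u same → ⊥-elim (none u same)
    ; f-injective = λ u _ same _ _ → ⊥-elim (none u same)
    ; spare = w
    ; spare-opposite = w-opposite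
    ; spare-missed = λ u same _ → ⊥-elim (none u same) }

true≢false : true ≢ false
true≢false ()

prime>1 : ∀ {p} → Prime p → 1 < p
prime>1 {p} p-prime = nonTrivial⇒n>1 p {{prime⇒nonTrivial p-prime}}

prime∤⇒coprime : ∀ {p x} → Prime p → ¬ p ∣ x → Coprime p x
prime∤⇒coprime p-prime p∤x {i} (i∣p , i∣x) with prime⇒irreducible p-prime i∣p
... | inj₁ i≡1 = i≡1
... | inj₂ i≡p = ⊥-elim (p∤x (subst (_∣ _) i≡p i∣x))

distinct-primes-∤ : ∀ {p q} → Prime p → Prime q → p ≢ q → ¬ p ∣ q
distinct-primes-∤ p-prime q-prime p≢q p∣q with prime⇒irreducible q-prime p∣q
... | inj₁ p≡1 = <⇒≢ (prime>1 p-prime) (sym p≡1)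
... | inj₂ p≡q = p≢q p≡q

coprime-* : ∀ {a b x} → Coprime a x → Coprime b x → Coprime (a * b) x
coprime-* a⊥x b⊥x {i} (i∣ab , i∣x) = b⊥x (coprime-divisor i⊥a i∣ab , i∣x)
  where
    i⊥a : Coprime i _
    i⊥a (j∣i , j∣a) = a⊥x (j∣a , ∣-trans j∣i i∣x)

coprime-∣⇒*∣ : ∀ {a b x} → Coprime a b → a ∣ x → b ∣ x → a * b ∣ x
coprime-∣⇒*∣ {a} {b} a⊥b a∣x (divides k refl) with coprime-divisor a⊥b (subst (a ∣_) (*-comm k b) a∣x)
... | divides c refl = divides c (*-assoc c a b)

coprime-annihilator : ∀ {d n x y} → Coprime d x → d ∣ n → n ∣ x * y → d ∣ y
coprime-annihilator d⊥x d∣n n∣xy = coprime-divisor d⊥x (∣-trans d∣n n∣xy)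

∣∧<⇒≡0 : ∀ {n y} → n ∣ y → y < n → y ≡ 0
∣∧<⇒≡0 {y = zero} _ _ = refl
∣∧<⇒≡0 {y = suc _} n∣y y<n = ⊥-elim (<⇒≱ y<n (∣⇒≤ n∣y))

next-multiple-≤ : ∀ {d n u} → d ∣ u → d ∣ n → u < n → u + d ≤ n
next-multiple-≤ {d} (divides a refl) (divides b refl) au<bu =
  subst (_≤ b * d) (+-comm d (a * d)) (*-monoˡ-≤ d (*-cancelʳ-< d a b au<bu))

-- The zero-divisor graph of ℤ_n

module ZeroDivisors (n : ℕ) where
  open FinGraph (ZeroDivisorGraph n) public using (vert)
  open Criterion (ZeroDivisorGraph n) public

  vertex : (v : Fin n) (y : ℕ) → toℕ v ≢ 0 → y ≢ 0 → y < n → n ∣ toℕ v * y → vert v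
  vertex v y v≢0 y≢0 y<n n∣vy =
    v≢0 , fromℕ< y<n , subst (_≢ 0) (sym (toℕ-fromℕ< y<n)) y≢0
        , subst (λ z → n ∣ toℕ v * z) (sym (toℕ-fromℕ< y<n)) n∣vy

  factor-vertex : ∀ x y → n ≡ x * y → 1 < x → 1 < y → Σ[ w ∈ Fin n ] toℕ w ≡ x × vert w
  factor-vertex x y n≡xy x>1 y>1 =
    w , toℕ-fromℕ< x<n ,
    vertex w y w≢0 (≢-nonZero⁻¹ y) y<n
      (subst (n ∣_) (cong (_* y) (sym (toℕ-fromℕ< x<n))) (∣-reflexive n≡xy))
    where
      instance
        x≢0 : NonZero x
        x≢0 = >-nonZero (<-trans (s≤s z≤n) x>1)
        y≢0 : NonZero y
        y≢0 = >-nonZero (<-trans (s≤s z≤n) y>1)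
      x<n : x < n
      x<n = subst (x <_) (sym n≡xy) (m<m*n x y y>1)
      y<n : y < n
      y<n = subst (y <_) (trans (*-comm y x) (sym n≡xy)) (m<m*n y x x>1)
      w : Fin n
      w = fromℕ< x<n
      w≢0 : toℕ w ≢ 0
      w≢0 w≡0 = ≢-nonZero⁻¹ x (trans (sym (toℕ-fromℕ< x<n)) w≡0)

  -- A vertex is never coprime to n: n would then divide its nonzero annihilator.
  vertex⇒¬coprime : ∀ {v} → vert v → ¬ Coprime n (toℕ v)
  vertex⇒¬coprime (_ , y , y≢0 , n∣vy) n⊥v = y≢0 (∣∧<⇒≡0 (coprime-divisor n⊥v n∣vy) (toℕ<n y))

  vertex⇒n∤ : ∀ {u} → vert u → ¬ n ∣ toℕ u
  vertex⇒n∤ {u} (u≢0 , _) n∣u = u≢0 (∣∧<⇒≡0 n∣u (toℕ<n u))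

  opposite-neighbour : ∀ S {v u} → vert u → n ∣ toℕ v * toℕ u → S u ≡ not (S v) →
    Neighbour S v (not (S v)) u
  opposite-neighbour S u-vert n∣vu Su = (u-vert , (λ v≡u → not-¬ refl (trans (cong S v≡u) Su)) , n∣vu) , Su

-- Pairing 1 ↔ 2, 3 ↔ 4, 5 ↔ 6, … and colourings alternating on the pairs

swap : ℕ → ℕ
swap 0 = 1
swap 1 = 0
swap (suc (suc i)) = suc (suc (swap i))

swap-involutive : ∀ i → swap (swap i) ≡ i
swap-involutive 0 = refl
swap-involutive 1 = refl
swap-involutive (suc (suc i)) = cong (λ k → suc (suc k)) (swap-involutive i)

swap-step : ∀ i → (swap i ≡ suc i × 2 ∣ i) ⊎ suc (swap i) ≡ i
swap-step 0 = inj₁ (refl , divides 0 refl)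
swap-step 1 = inj₂ refl
swap-step (suc (suc i)) with swap-step i
... | inj₁ (up , 2∣i) = inj₁ (cong (λ k → suc (suc k)) up , ∣m∣n⇒∣m+n ∣-refl 2∣i)
... | inj₂ down = inj₂ (cong (λ k → suc (suc k)) down)

partner : ℕ → ℕ
partner zero = zero
partner (suc i) = suc (swap i)

partner-involutive : ∀ k → partner (partner k) ≡ k
partner-involutive zero = refl
partner-involutive (suc i) = cong suc (swap-involutive i)

partner-step : ∀ k → k ≢ 0 → (partner k ≡ suc k × 2 ∣ suc k) ⊎ suc (partner k) ≡ k
partner-step zero k≢0 = ⊥-elim (k≢0 refl)
partner-step (suc i) _ with swap-step i
... | inj₁ (up , 2∣i) = inj₁ (cong suc up , ∣m∣n⇒∣m+n ∣-refl 2∣i)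
... | inj₂ down = inj₂ (cong suc down)

partner-≢0 : ∀ k → k ≢ 0 → partner k ≢ 0
partner-≢0 zero k≢0 = ⊥-elim (k≢0 refl)
partner-≢0 (suc i) _ ()

partner-≢ : ∀ k → k ≢ 0 → partner k ≢ k
partner-≢ k k≢0 with partner-step k k≢0
... | inj₁ (up , _) = λ eq → <⇒≢ (n<1+n k) (trans (sym eq) up)
... | inj₂ down = λ eq → <⇒≢ (n<1+n k) (sym (trans (cong suc (sym eq)) down))

partner-< : ∀ {k r} → k ≢ 0 → k < r → ¬ 2 ∣ r → partner k < r
partner-< {k} k≢0 k<r r-odd with partner-step k k≢0
... | inj₁ (up , 2∣k+1) = subst (_< _) (sym up) (≤∧≢⇒< k<r (λ k+1≡r → r-odd (subst (2 ∣_) k+1≡r 2∣k+1)))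
... | inj₂ down = <-trans (subst (partner k <_) down ≤-refl) k<r

partner-common-divisor : ∀ {d} k → 1 < d → k ≢ 0 → d ∣ k → d ∣ partner k → ⊥
partner-common-divisor {d} k d>1 k≢0 d∣k d∣k' = <⇒≢ d>1 (sym (∣1⇒≡1 (consecutive (partner-step k k≢0))))
  where
    consecutive : (partner k ≡ suc k × 2 ∣ suc k) ⊎ suc (partner k) ≡ k → d ∣ 1
    consecutive (inj₁ (up , _)) = ∣m+n∣m⇒∣n (subst (d ∣_) (trans up (+-comm 1 k)) d∣k') d∣k
    consecutive (inj₂ down) = ∣m+n∣m⇒∣n (subst (d ∣_) (trans (sym down) (+-comm 1 (partner k))) d∣k) d∣k'

<?-flip : ∀ {a b} → a ≢ b → does (b <? a) ≡ not (does (a <? b))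
<?-flip {a} {b} a≢b with <-cmp a b
... | tri< a<b _ _ rewrite dec-true (a <? b) a<b | dec-false (b <? a) (<⇒≯ a<b) = refl
... | tri≈ _ a≡b _ = ⊥-elim (a≢b a≡b)
... | tri> _ _ b<a rewrite dec-false (a <? b) (<⇒≯ b<a) | dec-true (b <? a) b<a = refl

-- choose t f t' f' o: the colour of k when t/f say that k is forced true/false,
-- t'/f' that its partner is forced true/false, and o is the tie-break.
choose : Bool → Bool → Bool → Bool → Bool → Bool
choose true  _     _     _     _ = true
choose false true  _     _     _ = false
choose false false true  _     _ = false
choose false false false true  _ = true
choose false false false false o = o

choose-flip : ∀ t f t' f' o → t ∧ f ≡ false → t' ∧ f' ≡ false → t ∧ t' ≡ false → f ∧ f' ≡ false →
  choose t' f' t f (not o) ≡ not (choose t f t' f' o)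
choose-flip true  false false true  _ _ _ _ _ = refl
choose-flip true  false false false _ _ _ _ _ = refl
choose-flip false true  true  false _ _ _ _ _ = refl
choose-flip false true  false false _ _ _ _ _ = refl
choose-flip false false true  false _ _ _ _ _ = refl
choose-flip false false false true  _ _ _ _ _ = refl
choose-flip false false false false _ _ _ _ _ = refl
choose-flip true  true  _     _     _ () _  _  _
choose-flip true  false true  _     _ _  _  () _
choose-flip false true  _     true  _ _  _  _  ()
choose-flip false false true  true  _ _  () _  _

does-∧-false : ∀ {A B : Set} (a? : Dec A) (b? : Dec B) → (A → B → ⊥) → does a? ∧ does b? ≡ false
does-∧-false (yes a) (yes b) exclusive = ⊥-elim (exclusive a b)
does-∧-false (yes _) (no _) _ = refl
does-∧-false (no _) _ _ = refl

module PairColouring (T F : ℕ → Bool) where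
  colour : ℕ → Bool
  colour k = choose (T k) (F k) (T (partner k)) (F (partner k)) (does (k <? partner k))

  colour-T : ∀ {k} → T k ≡ true → colour k ≡ true
  colour-T {k} Tk = cong (λ t → choose t (F k) (T (partner k)) (F (partner k)) (does (k <? partner k))) Tk

  colour-F : ∀ {k} → T k ≡ false → F k ≡ true → colour k ≡ false
  colour-F {k} Tk Fk = cong₂ (λ t f → choose t f (T (partner k)) (F (partner k)) (does (k <? partner k))) Tk Fk

  colour-flip : ∀ k → k ≢ 0 → T k ∧ F k ≡ false → T (partner k) ∧ F (partner k) ≡ false →
    T k ∧ T (partner k) ≡ false → F k ∧ F (partner k) ≡ false → colour (partner k) ≡ not (colour k)
  colour-flip k k≢0 k-unforced k'-unforced T-apart F-apart = begin
    colour k'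
      ≡⟨ cong (λ x → choose (T k') (F k') (T x) (F x) (does (k' <? x))) (partner-involutive k) ⟩
    choose (T k') (F k') (T k) (F k) (does (k' <? k))
      ≡⟨ cong (choose (T k') (F k') (T k) (F k)) (<?-flip (≢-sym (partner-≢ k k≢0))) ⟩
    choose (T k') (F k') (T k) (F k) (not (does (k <? k')))
      ≡⟨ choose-flip (T k) (F k) (T k') (F k') (does (k <? k')) k-unforced k'-unforced T-apart F-apart ⟩
    not (colour k) ∎
    where
      open ≡-Reasoning
      k' = partner k

-- Part (i): n = p²q

module SquareTimesPrime (p q : ℕ) (p-prime : Prime p) (q-prime : Prime q) (p≢q : p ≢ q) where
  instance
    p≢0 : NonZero p
    p≢0 = prime⇒nonZero p-prime
    q≢0 : NonZero q
    q≢0 = prime⇒nonZero q-prime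
    pq≢0 : NonZero (p * q)
    pq≢0 = m*n≢0 p q

  N : ℕ
  N = p ^ 2 * q

  open ZeroDivisors N

  N≡pq*p : N ≡ p * q * p
  N≡pq*p = lemma p q where lemma : ∀ p q → p * (p * 1) * q ≡ p * q * p ; lemma = solve-∀
  N≡pp*q : N ≡ p * p * q
  N≡pp*q = lemma p q where lemma : ∀ p q → p * (p * 1) * q ≡ p * p * q ; lemma = solve-∀
  N≡p*pq : N ≡ p * (p * q)
  N≡p*pq = lemma p q where lemma : ∀ p q → p * (p * 1) * q ≡ p * (p * q) ; lemma = solve-∀
  N≡q*pp : N ≡ q * (p * p)
  N≡q*pp = lemma p q where lemma : ∀ p q → p * (p * 1) * q ≡ q * (p * p) ; lemma = solve-∀

  instance
    N≢0 : NonZero N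
    N≢0 = subst NonZero (sym N≡pp*q) (m*n≢0 (p * p) q {{m*n≢0 p p}})

  p>1 : 1 < p
  p>1 = prime>1 p-prime
  q>1 : 1 < q
  q>1 = prime>1 q-prime

  p⊥q : Coprime p q
  p⊥q = prime∤⇒coprime p-prime (distinct-primes-∤ p-prime q-prime p≢q)

  q∤p : ¬ q ∣ p
  q∤p = distinct-primes-∤ q-prime p-prime (≢-sym p≢q)

  side : Fin N → Bool
  side u = not (does (q ∣? toℕ u))

  side-q∤ : ∀ {u} → ¬ q ∣ toℕ u → side u ≡ true
  side-q∤ {u} q∤u = cong not (dec-false (q ∣? toℕ u) q∤u)

  side-q∣ : ∀ {u} → q ∣ toℕ u → side u ≡ false
  side-q∣ {u} q∣u = cong not (dec-true (q ∣? toℕ u) q∣u)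

  side-false⇒q∣ : ∀ {u} → side u ≡ false → q ∣ toℕ u
  side-false⇒q∣ {u} side≡false with q ∣? toℕ u
  ... | yes q∣u = q∣u
  ... | no _ = ⊥-elim (true≢false side≡false)

  pp∣∧q∣⇒N∣ : ∀ {x} → p * p ∣ x → q ∣ x → N ∣ x
  pp∣∧q∣⇒N∣ pp∣x q∣x = ∣-trans (∣-reflexive N≡pp*q) (coprime-∣⇒*∣ (coprime-* p⊥q p⊥q) pp∣x q∣x)

  p∤⇒pp∣ : ∀ {x y} → ¬ p ∣ x → N ∣ x * y → p * p ∣ y
  p∤⇒pp∣ p∤x N∣xy =
    coprime-annihilator (coprime-* p⊥x p⊥x) (∣-trans (m∣m*n q) (∣-reflexive (sym N≡pp*q))) N∣xy
    where p⊥x = prime∤⇒coprime p-prime p∤x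

  q∤⇒p∣ : ∀ {v} → vert v → ¬ q ∣ toℕ v → p ∣ toℕ v
  q∤⇒p∣ {v} v-vert q∤v with p ∣? toℕ v
  ... | yes p∣v = p∣v
  ... | no p∤v = ⊥-elim (vertex⇒¬coprime v-vert (subst (λ n → Coprime n (toℕ v)) (sym N≡pp*q)
          (coprime-* (coprime-* p⊥v p⊥v) (prime∤⇒coprime q-prime q∤v))))
    where p⊥v = prime∤⇒coprime p-prime p∤v

  -- v ∉ qℤ: every neighbour lies in qℤ (q ∣ v·u), and pq is one.
  outnumbered-q∤ : ∀ v → vert v → ¬ q ∣ toℕ v → Outnumbered side v
  outnumbered-q∤ v v-vert q∤v = outnumbered-trivially side v none w w-opposite
    where
      none : ∀ u → ¬ Neighbour side v (side v) u
      none u ((_ , _ , N∣vu) , same) =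
        true≢false (trans (sym (side-q∤ q∤v)) (trans (sym same) (side-q∣ q∣u)))
        where
          q∣u : q ∣ toℕ u
          q∣u = coprime-annihilator (prime∤⇒coprime q-prime q∤v)
                  (∣-trans (∣m⇒∣m*n p (n∣m*n p)) (∣-reflexive (sym N≡pq*p))) N∣vu
      pq = factor-vertex (p * q) p N≡pq*p (<-≤-trans p>1 (m≤m*n p q)) p>1
      w = proj₁ pq
      w≡pq = proj₁ (proj₂ pq)
      w-opposite : Neighbour side v (not (side v)) w
      w-opposite = opposite-neighbour side (proj₂ (proj₂ pq))
        (subst (λ x → N ∣ toℕ v * x) (sym w≡pq)
          (∣-trans (∣-reflexive N≡p*pq) (*-pres-∣ (q∤⇒p∣ v-vert q∤v) ∣-refl)))
        (trans (side-q∣ (subst (q ∣_) (sym w≡pq) (n∣m*n p))) (cong not (sym (side-q∤ q∤v))))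

  -- v ∈ qℤ ∖ pℤ: a neighbour u of the same colour would lie in p²ℤ ∩ qℤ = Nℤ;
  -- p² is a neighbour of the other colour.
  outnumbered-q∣-p∤ : ∀ v → vert v → q ∣ toℕ v → ¬ p ∣ toℕ v → Outnumbered side v
  outnumbered-q∣-p∤ v v-vert q∣v p∤v = outnumbered-trivially side v none w w-opposite
    where
      none : ∀ u → ¬ Neighbour side v (side v) u
      none u ((u-vert , _ , N∣vu) , same) =
        vertex⇒n∤ u-vert (pp∣∧q∣⇒N∣ (p∤⇒pp∣ p∤v N∣vu) (side-false⇒q∣ (trans same (side-q∣ q∣v))))
      pp = factor-vertex (p * p) q N≡pp*q (<-≤-trans p>1 (m≤m*n p p)) q>1
      w = proj₁ pp
      w≡pp = proj₁ (proj₂ pp)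
      q∤w : ¬ q ∣ toℕ w
      q∤w q∣w = q∤p (coprime-divisor (prime∤⇒coprime q-prime q∤p) (subst (q ∣_) w≡pp q∣w))
      w-opposite : Neighbour side v (not (side v)) w
      w-opposite = opposite-neighbour side (proj₂ (proj₂ pp))
        (subst (λ x → N ∣ toℕ v * x) (sym w≡pp)
          (∣-trans (∣-reflexive N≡q*pp) (*-pres-∣ q∣v ∣-refl)))
        (trans (side-q∤ q∤w) (cong not (sym (side-q∣ q∣v))))

  -- Translation by p, which maps pqℤ into the other colour.
  shift : Fin N → Fin N
  shift u = fromℕ< (m%n<n (toℕ u + p) N)

  toℕ-shift : ∀ {u} → p * q ∣ toℕ u → toℕ (shift u) ≡ toℕ u + p
  toℕ-shift {u} pq∣u = trans (toℕ-fromℕ< _) (m<n⇒m%n≡m u+p<N)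
    where
      u+p<N : toℕ u + p < N
      u+p<N = <-≤-trans (+-monoʳ-< (toℕ u) (m<m*n p q q>1))
                (next-multiple-≤ pq∣u (∣-trans (∣m⇒∣m*n p ∣-refl) (∣-reflexive (sym N≡pq*p))) (toℕ<n u))

  shift-injective : ∀ {u w} → p * q ∣ toℕ u → p * q ∣ toℕ w → shift u ≡ shift w → u ≡ w
  shift-injective {u} {w} pq∣u pq∣w eq =
    toℕ-injective (+-cancelʳ-≡ p (toℕ u) (toℕ w)
      (trans (sym (toℕ-shift pq∣u)) (trans (cong toℕ eq) (toℕ-shift pq∣w))))

  shift-opposite : ∀ {v u} → p * q ∣ toℕ v → p * q ∣ toℕ u → Neighbour side v (not (side v)) (shift u)
  shift-opposite {v} {u} pq∣v pq∣u = opposite-neighbour side shift-vert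
    (subst (λ x → N ∣ toℕ v * x) (sym (toℕ-shift pq∣u))
      (∣-trans (∣-reflexive N≡pq*p) (*-pres-∣ pq∣v p∣u+p)))
    (trans (side-q∤ q∤u+p) (cong not (sym (side-q∣ (∣-trans (n∣m*n p) pq∣v)))))
    where
      p∣u+p : p ∣ toℕ u + p
      p∣u+p = ∣m∣n⇒∣m+n (∣-trans (m∣m*n q) pq∣u) ∣-refl
      q∤u+p : ¬ q ∣ toℕ (shift u)
      q∤u+p q∣shift = q∤p (∣m+n∣m⇒∣n (subst (q ∣_) (toℕ-shift pq∣u) q∣shift) (∣-trans (n∣m*n p) pq∣u))
      shift-vert : vert (shift u)
      shift-vert = vertex (shift u) (p * q)
        (λ shift≡0 → ≢-nonZero⁻¹ p (m+n≡0⇒n≡0 (toℕ u) (trans (sym (toℕ-shift pq∣u)) shift≡0)))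
        (≢-nonZero⁻¹ (p * q))
        (subst (p * q <_) (sym N≡pq*p) (m<m*n (p * q) p p>1))
        (subst (λ x → N ∣ x * (p * q)) (sym (toℕ-shift pq∣u))
          (∣-trans (∣-reflexive N≡p*pq) (*-pres-∣ p∣u+p ∣-refl)))

  -- v ∈ pqℤ: neighbours of the same colour lie in pqℤ (a neighbour outside pℤ
  -- would force p² ∣ v and so N ∣ v), and the shift carries them injectively
  -- to the other colour, missing v + p.
  outnumbered-pq∣ : ∀ v → vert v → p * q ∣ toℕ v → Outnumbered side v
  outnumbered-pq∣ v v-vert pq∣v = record
    { f = shift
    ; f-opposite = λ u same → shift-opposite pq∣v (same⇒pq∣ u same)
    ; f-injective = λ u w u-same w-same → shift-injective (same⇒pq∣ u u-same) (same⇒pq∣ w w-same)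
    ; spare = shift v
    ; spare-opposite = shift-opposite pq∣v pq∣v
    ; spare-missed = λ { u same@((_ , v≢u , _) , _) eq → v≢u (sym (shift-injective (same⇒pq∣ u same) pq∣v eq)) } }
    where
      q∣v : q ∣ toℕ v
      q∣v = ∣-trans (n∣m*n p) pq∣v
      same⇒pq∣ : ∀ u → Neighbour side v (side v) u → p * q ∣ toℕ u
      same⇒pq∣ u ((_ , _ , N∣vu) , same) with p ∣? toℕ u
      ... | yes p∣u = coprime-∣⇒*∣ p⊥q p∣u q∣u
        where q∣u = side-false⇒q∣ (trans same (side-q∣ q∣v))
      ... | no p∤u = ⊥-elim (vertex⇒n∤ v-vert
              (pp∣∧q∣⇒N∣ (p∤⇒pp∣ p∤u (subst (N ∣_) (*-comm (toℕ v) (toℕ u)) N∣vu)) q∣v))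

  outnumbered : ∀ v → vert v → Outnumbered side v
  outnumbered v v-vert with q ∣? toℕ v | p ∣? toℕ v
  ... | no q∤v | _ = outnumbered-q∤ v v-vert q∤v
  ... | yes q∣v | no p∤v = outnumbered-q∣-p∤ v v-vert q∣v p∤v
  ... | yes q∣v | yes p∣v = outnumbered-pq∣ v v-vert (coprime-∣⇒*∣ p⊥q p∣v q∣v)

  veryCostEffective : VeryCostEffectiveGraph (ZeroDivisorGraph N)
  veryCostEffective = outnumbered⇒veryCostEffective side outnumbered

-- Part (ii): n = p²q² with pq odd

module SquareTimesSquare (p q : ℕ) (p-prime : Prime p) (q-prime : Prime q) (p≢q : p ≢ q)
                         (pq-odd : ¬ 2 ∣ p * q) where
  r : ℕ
  r = p * q

  N : ℕ
  N = p ^ 2 * q ^ 2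

  instance
    p≢0 : NonZero p
    p≢0 = prime⇒nonZero p-prime
    q≢0 : NonZero q
    q≢0 = prime⇒nonZero q-prime
    r≢0 : NonZero r
    r≢0 = m*n≢0 p q

  N≡r*r : N ≡ r * r
  N≡r*r = lemma p q where lemma : ∀ p q → p * (p * 1) * (q * (q * 1)) ≡ p * q * (p * q) ; lemma = solve-∀
  N≡qr*p : N ≡ q * r * p
  N≡qr*p = lemma p q where lemma : ∀ p q → p * (p * 1) * (q * (q * 1)) ≡ q * (p * q) * p ; lemma = solve-∀
  N≡p*qr : N ≡ p * (q * r)
  N≡p*qr = lemma p q where lemma : ∀ p q → p * (p * 1) * (q * (q * 1)) ≡ p * (q * (p * q)) ; lemma = solve-∀
  N≡pr*q : N ≡ p * r * q
  N≡pr*q = lemma p q where lemma : ∀ p q → p * (p * 1) * (q * (q * 1)) ≡ p * (p * q) * q ; lemma = solve-∀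
  N≡q*pr : N ≡ q * (p * r)
  N≡q*pr = lemma p q where lemma : ∀ p q → p * (p * 1) * (q * (q * 1)) ≡ q * (p * (p * q)) ; lemma = solve-∀

  instance
    N≢0 : NonZero N
    N≢0 = subst NonZero (sym N≡r*r) (m*n≢0 r r)

  open ZeroDivisors N

  p>1 : 1 < p
  p>1 = prime>1 p-prime
  q>1 : 1 < q
  q>1 = prime>1 q-prime
  r>1 : 1 < r
  r>1 = <-≤-trans p>1 (m≤m*n p q)

  p∤q : ¬ p ∣ q
  p∤q = distinct-primes-∤ p-prime q-prime p≢q
  q∤p : ¬ q ∣ p
  q∤p = distinct-primes-∤ q-prime p-prime (≢-sym p≢q)

  p⊥q : Coprime p q
  p⊥q = prime∤⇒coprime p-prime p∤q

  pp∣N : p * p ∣ N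
  pp∣N = ∣-trans (*-pres-∣ (m∣m*n {p} q) (m∣m*n {p} q)) (∣-reflexive (sym N≡r*r))
  qq∣N : q * q ∣ N
  qq∣N = ∣-trans (*-pres-∣ (n∣m*n p {q}) (n∣m*n p {q})) (∣-reflexive (sym N≡r*r))

  -- Products of multiples of r vanish: the multiples of r form a clique.
  r∣∧r∣⇒N∣* : ∀ {x y} → r ∣ x → r ∣ y → N ∣ x * y
  r∣∧r∣⇒N∣* r∣x r∣y = ∣-trans (∣-reflexive N≡r*r) (*-pres-∣ r∣x r∣y)

  pp∣jr⇒p∣j : ∀ j → p * p ∣ j * r → p ∣ j
  pp∣jr⇒p∣j j pp∣jr = coprime-divisor p⊥q (subst (p ∣_) (*-comm j q)
    (*-cancelʳ-∣ p (subst (p * p ∣_) (lemma j p q) pp∣jr)))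
    where lemma : ∀ j p q → j * (p * q) ≡ j * q * p ; lemma = solve-∀
  qq∣jr⇒q∣j : ∀ j → q * q ∣ j * r → q ∣ j
  qq∣jr⇒q∣j j qq∣jr = coprime-divisor (prime∤⇒coprime q-prime q∤p) (subst (q ∣_) (*-comm j p)
    (*-cancelʳ-∣ q (subst (q * q ∣_) (sym (*-assoc j p q)) qq∣jr)))

  index-not-both : ∀ {j} → j ≢ 0 → j < r → p ∣ j → q ∣ j → ⊥
  index-not-both j≢0 j<r p∣j q∣j = j≢0 (∣∧<⇒≡0 (coprime-∣⇒*∣ p⊥q p∣j q∣j) j<r)

  -- Multiples j·r are coloured by the pair colouring of j, multiples of q
  -- being forced true and multiples of p false; the rest by "q ∣ u".
  open PairColouring (λ k → does (q ∣? k)) (λ k → does (p ∣? k))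

  colourℕ : ℕ → Bool
  colourℕ x = if does (r ∣? x) then colour (x / r) else does (q ∣? x)

  side : Fin N → Bool
  side u = colourℕ (toℕ u)

  side-multiple : ∀ {u} j → toℕ u ≡ j * r → side u ≡ colour j
  side-multiple {u} j u≡jr = trans (cong colourℕ u≡jr) (colourℕ-jr j)
    where
      colourℕ-jr : ∀ j → colourℕ (j * r) ≡ colour j
      colourℕ-jr j with r ∣? j * r
      ... | yes _ = cong colour (m*n/n≡m j r)
      ... | no r∤jr = ⊥-elim (r∤jr (n∣m*n j))

  side-q∣ : ∀ {u} → ¬ r ∣ toℕ u → q ∣ toℕ u → side u ≡ true
  side-q∣ {u} r∤u q∣u with r ∣? toℕ u
  ... | yes r∣u = ⊥-elim (r∤u r∣u)
  ... | no _ = dec-true (q ∣? toℕ u) q∣u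

  side-q∤ : ∀ {u} → ¬ r ∣ toℕ u → ¬ q ∣ toℕ u → side u ≡ false
  side-q∤ {u} r∤u q∤u with r ∣? toℕ u
  ... | yes r∣u = ⊥-elim (r∤u r∣u)
  ... | no _ = dec-false (q ∣? toℕ u) q∤u

  colour-q∣ : ∀ {j} → q ∣ j → colour j ≡ true
  colour-q∣ {j} q∣j = colour-T (dec-true (q ∣? j) q∣j)

  colour-p∣ : ∀ {j} → p ∣ j → ¬ q ∣ j → colour j ≡ false
  colour-p∣ {j} p∣j q∤j = colour-F (dec-false (q ∣? j) q∤j) (dec-true (p ∣? j) p∣j)

  record RMultiple (u : Fin N) : Set where
    constructor rmultiple
    field
      index : ℕ
      toℕ≡ : toℕ u ≡ index * r
      index≢0 : index ≢ 0
      index<r : index < r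

    r∣u : r ∣ toℕ u
    r∣u = divides index toℕ≡

  open RMultiple

  j<r⇒jr<N : ∀ {j} → j < r → j * r < N
  j<r⇒jr<N {j} j<r = subst (j * r <_) (sym N≡r*r) (*-monoˡ-< r j<r)

  vertex⇒rmultiple : ∀ {u} → vert u → r ∣ toℕ u → RMultiple u
  vertex⇒rmultiple {u} (u≢0 , _) (divides j u≡jr) = rmultiple j u≡jr
    (λ j≡0 → u≢0 (trans u≡jr (cong (_* r) j≡0)))
    (*-cancelʳ-< r j r (subst (_< r * r) u≡jr (subst (toℕ u <_) N≡r*r (toℕ<n u))))

  rmultiple⇒vertex : ∀ {u} → RMultiple u → vert u
  rmultiple⇒vertex {u} m = vertex u r
    (λ u≡0 → index≢0 m (m*n≡0⇒m≡0 (index m) r (trans (sym (toℕ≡ m)) u≡0)))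
    (≢-nonZero⁻¹ r)
    (subst (r <_) (sym N≡r*r) (m<m*n r r r>1))
    (r∣∧r∣⇒N∣* (r∣u m) ∣-refl)

  -- Partner indices receive opposite colours: partners are consecutive and
  -- below r, so none of them is forced both ways and no two are forced alike.
  index-flip : ∀ {j} → j ≢ 0 → j < r → colour (partner j) ≡ not (colour j)
  index-flip {j} j≢0 j<r = colour-flip j j≢0
    (unforced j≢0 j<r)
    (unforced (partner-≢0 j j≢0) (partner-< j≢0 j<r pq-odd))
    (does-∧-false (q ∣? j) (q ∣? partner j) (partner-common-divisor j q>1 j≢0))
    (does-∧-false (p ∣? j) (p ∣? partner j) (partner-common-divisor j p>1 j≢0))
    where
      unforced : ∀ {k} → k ≢ 0 → k < r → does (q ∣? k) ∧ does (p ∣? k) ≡ false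
      unforced {k} k≢0 k<r = does-∧-false (q ∣? k) (p ∣? k) (λ q∣k p∣k → index-not-both k≢0 k<r p∣k q∣k)

  pairing : Fin N → Fin N
  pairing u = fromℕ< (m%n<n (partner (toℕ u / r) * r) N)

  toℕ-pairing : ∀ {u} (m : RMultiple u) → toℕ (pairing u) ≡ partner (index m) * r
  toℕ-pairing {u} m = begin
    toℕ (pairing u)                     ≡⟨ toℕ-fromℕ< _ ⟩
    (partner (toℕ u / r) * r) % N       ≡⟨ cong (λ x → (partner (x / r) * r) % N) (toℕ≡ m) ⟩
    (partner (index m * r / r) * r) % N ≡⟨ cong (λ x → (partner x * r) % N) (m*n/n≡m (index m) r) ⟩
    (partner (index m) * r) % N         ≡⟨ m<n⇒m%n≡m (j<r⇒jr<N (partner-< (index≢0 m) (index<r m) pq-odd)) ⟩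
    partner (index m) * r               ∎
    where open ≡-Reasoning

  pairing-rmultiple : ∀ {u} → RMultiple u → RMultiple (pairing u)
  pairing-rmultiple m = rmultiple (partner (index m)) (toℕ-pairing m)
    (partner-≢0 (index m) (index≢0 m)) (partner-< (index≢0 m) (index<r m) pq-odd)

  pairing-flip : ∀ {u} → RMultiple u → side (pairing u) ≡ not (side u)
  pairing-flip m = trans (side-multiple _ (toℕ-pairing m))
    (trans (index-flip (index≢0 m) (index<r m)) (cong not (sym (side-multiple _ (toℕ≡ m)))))

  pairing-injective : ∀ {u w} → RMultiple u → RMultiple w → pairing u ≡ pairing w → u ≡ w
  pairing-injective {u} {w} mu mw eq = toℕ-injective (begin
    toℕ u                                  ≡⟨ toℕ≡ mu ⟩
    index mu * r                           ≡⟨ cong (_* r) (sym (partner-involutive (index mu))) ⟩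
    partner (partner (index mu)) * r       ≡⟨ cong (λ x → partner x * r) partners≡ ⟩
    partner (partner (index mw)) * r       ≡⟨ cong (_* r) (partner-involutive (index mw)) ⟩
    index mw * r                           ≡⟨ sym (toℕ≡ mw) ⟩
    toℕ w                                  ∎)
    where
      open ≡-Reasoning
      partners≡ : partner (index mu) ≡ partner (index mw)
      partners≡ = *-cancelʳ-≡ _ _ r (trans (sym (toℕ-pairing mu)) (trans (cong toℕ eq) (toℕ-pairing mw)))

  -- A vertex outside qℤ lies in pℤ, since it is not coprime to N.
  q∤⇒p∣ : ∀ {v} → vert v → ¬ q ∣ toℕ v → p ∣ toℕ v
  q∤⇒p∣ {v} v-vert q∤v with p ∣? toℕ v
  ... | yes p∣v = p∣v
  ... | no p∤v = ⊥-elim (vertex⇒¬coprime v-vert (subst (λ n → Coprime n (toℕ v)) (sym N≡r*r)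
          (coprime-* r⊥v r⊥v)))
    where r⊥v = coprime-* (prime∤⇒coprime p-prime p∤v) (prime∤⇒coprime q-prime q∤v)

  -- v ∉ qℤ (coloured false): a neighbour u has q ∣ u and q² ∣ u; off rℤ this
  -- colours u true, and u = j·r forces q ∣ j, again colouring u true.
  -- The multiple q·r is a neighbour coloured true.
  outnumbered-q∤ : ∀ v → vert v → ¬ q ∣ toℕ v → Outnumbered side v
  outnumbered-q∤ v v-vert q∤v = outnumbered-trivially side v none w w-opposite
    where
      q⊥v = prime∤⇒coprime q-prime q∤v
      side-v : side v ≡ false
      side-v = side-q∤ (λ r∣v → q∤v (∣-trans (n∣m*n p) r∣v)) q∤v
      none : ∀ u → ¬ Neighbour side v (side v) u
      none u ((u-vert , _ , N∣vu) , same) = by-cases (r ∣? toℕ u)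
        where
          by-cases : Dec (r ∣ toℕ u) → ⊥
          by-cases (yes r∣u) = true≢false (trans (sym (colour-q∣ (qq∣jr⇒q∣j j (subst (q * q ∣_) (toℕ≡ m) qq∣u))))
                          (trans (sym (side-multiple j (toℕ≡ m))) (trans same side-v)))
            where
              m = vertex⇒rmultiple u-vert r∣u
              j = index m
              qq∣u = coprime-annihilator (coprime-* q⊥v q⊥v) qq∣N N∣vu
          by-cases (no r∤u) = true≢false (trans (sym (side-q∣ r∤u q∣u)) (trans same side-v))
            where q∣u = coprime-annihilator q⊥v (∣-trans (m∣m*n q) qq∣N) N∣vu
      qr = factor-vertex (q * r) p N≡qr*p (<-≤-trans q>1 (m≤m*n q r)) p>1
      w = proj₁ qr
      w≡qr = proj₁ (proj₂ qr)
      w-opposite : Neighbour side v (not (side v)) w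
      w-opposite = opposite-neighbour side (proj₂ (proj₂ qr))
        (subst (λ x → N ∣ toℕ v * x) (sym w≡qr)
          (∣-trans (∣-reflexive N≡p*qr) (*-pres-∣ (q∤⇒p∣ v-vert q∤v) ∣-refl)))
        (trans (side-multiple q w≡qr) (trans (colour-q∣ ∣-refl) (cong not (sym side-v))))

  -- v ∈ qℤ ∖ pℤ (coloured true): a neighbour u has p² ∣ u; off rℤ then q ∤ u
  -- and u is coloured false, and u = j·r forces p ∣ j, q ∤ j, colouring u false.
  -- The multiple p·r is a neighbour coloured false.
  outnumbered-q∣-p∤ : ∀ v → vert v → q ∣ toℕ v → ¬ p ∣ toℕ v → Outnumbered side v
  outnumbered-q∣-p∤ v v-vert q∣v p∤v = outnumbered-trivially side v none w w-opposite
    where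
      side-v : side v ≡ true
      side-v = side-q∣ (λ r∣v → p∤v (∣-trans (m∣m*n q) r∣v)) q∣v
      pp∣ : ∀ {u} → N ∣ toℕ v * toℕ u → p * p ∣ toℕ u
      pp∣ = coprime-annihilator (coprime-* p⊥v p⊥v) pp∣N
        where p⊥v = prime∤⇒coprime p-prime p∤v
      none : ∀ u → ¬ Neighbour side v (side v) u
      none u ((u-vert , _ , N∣vu) , same) = by-cases (r ∣? toℕ u)
        where
          by-cases : Dec (r ∣ toℕ u) → ⊥
          by-cases (yes r∣u) = true≢false (trans (trans (sym side-v) (trans (sym same) (side-multiple j (toℕ≡ m))))
                          (colour-p∣ p∣j (index-not-both (index≢0 m) (index<r m) p∣j)))
            where
              m = vertex⇒rmultiple u-vert r∣u
              j = index m
              p∣j = pp∣jr⇒p∣j j (subst (p * p ∣_) (toℕ≡ m) (pp∣ N∣vu))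
          by-cases (no r∤u) = true≢false (trans (sym side-v) (trans (sym same) (side-q∤ r∤u q∤u)))
            where
              q∤u : ¬ q ∣ toℕ u
              q∤u q∣u = r∤u (coprime-∣⇒*∣ p⊥q (∣-trans (m∣m*n p) (pp∣ N∣vu)) q∣u)
      pr = factor-vertex (p * r) q N≡pr*q (<-≤-trans p>1 (m≤m*n p r)) q>1
      w = proj₁ pr
      w≡pr = proj₁ (proj₂ pr)
      w-opposite : Neighbour side v (not (side v)) w
      w-opposite = opposite-neighbour side (proj₂ (proj₂ pr))
        (subst (λ x → N ∣ toℕ v * x) (sym w≡pr)
          (∣-trans (∣-reflexive N≡q*pr) (*-pres-∣ q∣v ∣-refl)))
        (trans (side-multiple p w≡pr) (trans (colour-p∣ ∣-refl q∤p) (cong not (sym side-v))))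

  -- v = k·r: a neighbour u off rℤ satisfies r ∣ k·u, so q ∣ u forces p ∣ k
  -- (v coloured false, u true) and q ∤ u forces q ∣ k (v true, u false).
  -- Hence v's same-coloured neighbours are multiples of r, and the pairing
  -- sends them injectively to neighbours of the other colour, missing pairing v.
  outnumbered-r∣ : ∀ v → RMultiple v → Outnumbered side v
  outnumbered-r∣ v mv = record
    { f = pairing
    ; f-opposite = λ u same → pairing-opposite (same⇒rmultiple u same) (proj₂ same)
    ; f-injective = λ u w u-same w-same → pairing-injective (same⇒rmultiple u u-same) (same⇒rmultiple w w-same)
    ; spare = pairing v
    ; spare-opposite = pairing-opposite mv refl
    ; spare-missed = λ { u same@((_ , v≢u , _) , _) eq → v≢u (sym (pairing-injective (same⇒rmultiple u same) mv eq)) } }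
    where
      k = index mv
      side-v : side v ≡ colour k
      side-v = side-multiple k (toℕ≡ mv)
      pairing-opposite : ∀ {u} → RMultiple u → side u ≡ side v → Neighbour side v (not (side v)) (pairing u)
      pairing-opposite mu same = opposite-neighbour side (rmultiple⇒vertex (pairing-rmultiple mu))
        (r∣∧r∣⇒N∣* (r∣u mv) (r∣u (pairing-rmultiple mu)))
        (trans (pairing-flip mu) (cong not same))
      r∣k* : ∀ {u} → N ∣ toℕ v * toℕ u → r ∣ k * toℕ u
      r∣k* {u} N∣vu = *-cancelˡ-∣ r (subst (r * r ∣_) vu≡r*ku (∣-trans (∣-reflexive (sym N≡r*r)) N∣vu))
        where
          lemma : ∀ k r u → k * r * u ≡ r * (k * u)
          lemma = solve-∀
          vu≡r*ku : toℕ v * toℕ u ≡ r * (k * toℕ u)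
          vu≡r*ku = trans (cong (_* toℕ u) (toℕ≡ mv)) (lemma k r (toℕ u))
      same⇒rmultiple : ∀ u → Neighbour side v (side v) u → RMultiple u
      same⇒rmultiple u ((u-vert , _ , N∣vu) , same) = by-cases (r ∣? toℕ u) (q ∣? toℕ u)
        where
          by-cases : Dec (r ∣ toℕ u) → Dec (q ∣ toℕ u) → RMultiple u
          by-cases (yes r∣u) _ = vertex⇒rmultiple u-vert r∣u
          by-cases (no r∤u) (yes q∣u) = ⊥-elim (true≢false (trans (sym (side-q∣ r∤u q∣u)) (trans same
                (trans side-v (colour-p∣ p∣k (index-not-both (index≢0 mv) (index<r mv) p∣k))))))
            where
              p∣k = coprime-divisor (prime∤⇒coprime p-prime (λ p∣u → r∤u (coprime-∣⇒*∣ p⊥q p∣u q∣u)))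
                    (subst (p ∣_) (*-comm k (toℕ u)) (∣-trans (m∣m*n q) (r∣k* N∣vu)))
          by-cases (no r∤u) (no q∤u) = ⊥-elim (true≢false (trans (sym (colour-q∣ q∣k)) (trans (sym side-v)
                (trans (sym same) (side-q∤ r∤u q∤u)))))
            where
              q∣k = coprime-divisor (prime∤⇒coprime q-prime q∤u)
                    (subst (q ∣_) (*-comm k (toℕ u)) (∣-trans (n∣m*n p) (r∣k* N∣vu)))

  outnumbered : ∀ v → vert v → Outnumbered side v
  outnumbered v v-vert with q ∣? toℕ v | p ∣? toℕ v
  ... | no q∤v | _ = outnumbered-q∤ v v-vert q∤v
  ... | yes q∣v | no p∤v = outnumbered-q∣-p∤ v v-vert q∣v p∤v
  ... | yes q∣v | yes p∣v = outnumbered-r∣ v (vertex⇒rmultiple v-vert (coprime-∣⇒*∣ p⊥q p∣v q∣v))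

  veryCostEffective : VeryCostEffectiveGraph (ZeroDivisorGraph N)
  veryCostEffective = outnumbered⇒veryCostEffective side outnumbered

prime≥3⇒odd : ∀ {p} → Prime p → 3 ≤ p → ¬ 2 ∣ p
prime≥3⇒odd p-prime p≥3 2∣p with prime⇒irreducible p-prime 2∣p
... | inj₁ ()
... | inj₂ 2≡p = <⇒≢ p≥3 2≡p

odd-primes-product : ∀ {p q} → Prime p → Prime q → 3 ≤ p → 3 ≤ q → ¬ 2 ∣ p * q
odd-primes-product {p} {q} p-prime q-prime p≥3 q≥3 2∣pq with euclidsLemma p q prime[2] 2∣pq
... | inj₁ 2∣p = prime≥3⇒odd p-prime p≥3 2∣p
... | inj₂ 2∣q = prime≥3⇒odd q-prime q≥3 2∣q

-- Part (i) holds for all distinct primes; part (ii) needs only p and q odd.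
mainTheorem3 : (p q : ℕ) → Prime p → Prime q → ¬ (p ≡ q) →
    ((2 ≤ p) → (2 ≤ q) → VeryCostEffectiveGraph (ZeroDivisorGraph (p ^ 2 * q)))
    × ((3 ≤ p) → (3 ≤ q) → p < q → VeryCostEffectiveGraph (ZeroDivisorGraph (p ^ 2 * q ^ 2)))
mainTheorem3 p q p-prime q-prime p≢q =
  (λ _ _ → SquareTimesPrime.veryCostEffective p q p-prime q-prime p≢q) ,
  (λ p≥3 q≥3 _ → SquareTimesSquare.veryCostEffective p q p-prime q-prime p≢q
                   (odd-primes-product p-prime q-prime p≥3 q≥3))
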